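{- For indeterminates $\mathbf a=(a_1,a_2,a_3)$, $\mathbf b=(b_1,b_2,b_3)$, $\mathbf z=(z_1,z_2,z_3)$, $$\sum_{i=1}^3\frac1{z_i}\prod_{j\ne i}\frac{z_i-z_j}{(a_i-a_j)(b_i-b_j)}=\frac{1}{z_1z_2z_3V(\mathbf a)V(\mathbf b)}\det\begin{pmatrix}a_1z_1&a_2z_2&a_3z_3\\ z_1&z_2&z_3\\ 1&1&1\end{pmatrix}\det\begin{pmatrix}b_1z_1&b_2z_2&b_3z_3\\ z_1&z_2&z_3\\ 1&1&1\end{pmatrix}.$$
   Context: $V(\mathbf x)=\prod_{i<j}(x_i-x_j)$ denotes the Vandermonde product. -}

module Defs where

open import Data.Rational using (ℚ; _+_; _-_; _*_)

V3 : ℚ → ℚ → ℚ → ℚ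
V3 x₁ x₂ x₃ = ((x₁ - x₂) * (x₁ - x₃)) * (x₂ - x₃)

det3 : ℚ → ℚ → ℚ → ℚ → ℚ → ℚ → ℚ → ℚ → ℚ → ℚ
det3 m₁₁ m₁₂ m₁₃ m₂₁ m₂₂ m₂₃ m₃₁ m₃₂ m₃₃ =
  ((((m₁₁ * m₂₂ * m₃₃ + m₁₂ * m₂₃ * m₃₁) + m₁₃ * m₂₁ * m₃₂)
    - m₁₃ * m₂₂ * m₃₁) - m₁₂ * m₂₁ * m₃₃) - m₁₁ * m₂₃ * m₃₂

module Submission where

open import Defs
open import Data.Rational using (ℚ; _+_; _-_; _*_; _÷_; 1/_; NonZero; 1ℚ)
open import Data.Rational.Properties using (*-inverseˡ; *-inverseʳ; *-identityˡ; *-identityʳ; *-assoc; *-distribʳ-+)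
open import Data.Rational.Solver using (module +-*-Solver)
open import Relation.Binary.PropositionalEquality using (_≡_; refl; sym; trans; cong; cong₂; module ≡-Reasoning)

open +-*-Solver
open ≡-Reasoning

-- Clearing the common denominator D = z₁z₂z₃V(a)V(b) turns the i-th summand into
-- r_i (z_i - z_j)(z_i - z_k) with r_i = z_j z_k (a_j - a_k)(b_j - b_k), j < k the other two
-- indices; the resulting polynomial identity is the product of the two determinants.

denominator : ℚ → ℚ → ℚ → ℚ → ℚ → ℚ → ℚ → ℚ → ℚ → ℚ
denominator a₁ a₂ a₃ b₁ b₂ b₃ z₁ z₂ z₃ = z₁ * z₂ * z₃ * V3 a₁ a₂ a₃ * V3 b₁ b₂ b₃

V3ᵖ : ∀ {n} → Polynomial n → Polynomial n → Polynomial n → Polynomial n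
V3ᵖ x₁ x₂ x₃ = (x₁ :- x₂) :* (x₁ :- x₃) :* (x₂ :- x₃)

denominatorᵖ : ∀ {n} → (a₁ a₂ a₃ b₁ b₂ b₃ z₁ z₂ z₃ : Polynomial n) → Polynomial n
denominatorᵖ a₁ a₂ a₃ b₁ b₂ b₃ z₁ z₂ z₃ = z₁ :* z₂ :* z₃ :* V3ᵖ a₁ a₂ a₃ :* V3ᵖ b₁ b₂ b₃

denominator-split : ∀ a₁ a₂ a₃ b₁ b₂ b₃ z₁ z₂ z₃ →
  denominator a₁ a₂ a₃ b₁ b₂ b₃ z₁ z₂ z₃
    ≡ z₁ * (a₁ - a₂) * (a₁ - a₃) * (b₁ - b₂) * (b₁ - b₃) * (z₂ * z₃ * (a₂ - a₃) * (b₂ - b₃))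
denominator-split = solve 9 (λ a₁ a₂ a₃ b₁ b₂ b₃ z₁ z₂ z₃ →
    denominatorᵖ a₁ a₂ a₃ b₁ b₂ b₃ z₁ z₂ z₃
    := z₁ :* (a₁ :- a₂) :* (a₁ :- a₃) :* (b₁ :- b₂) :* (b₁ :- b₃) :* (z₂ :* z₃ :* (a₂ :- a₃) :* (b₂ :- b₃)))
  refl

-- A transposition flips the sign of both Vandermonde factors.
denominator-swap₁₂ : ∀ a₁ a₂ a₃ b₁ b₂ b₃ z₁ z₂ z₃ →
  denominator a₁ a₂ a₃ b₁ b₂ b₃ z₁ z₂ z₃ ≡ denominator a₂ a₁ a₃ b₂ b₁ b₃ z₂ z₁ z₃
denominator-swap₁₂ = solve 9 (λ a₁ a₂ a₃ b₁ b₂ b₃ z₁ z₂ z₃ →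
    denominatorᵖ a₁ a₂ a₃ b₁ b₂ b₃ z₁ z₂ z₃
    := denominatorᵖ a₂ a₁ a₃ b₂ b₁ b₃ z₂ z₁ z₃)
  refl

denominator-rotate : ∀ a₁ a₂ a₃ b₁ b₂ b₃ z₁ z₂ z₃ →
  denominator a₁ a₂ a₃ b₁ b₂ b₃ z₁ z₂ z₃ ≡ denominator a₃ a₁ a₂ b₃ b₁ b₂ z₃ z₁ z₂
denominator-rotate = solve 9 (λ a₁ a₂ a₃ b₁ b₂ b₃ z₁ z₂ z₃ →
    denominatorᵖ a₁ a₂ a₃ b₁ b₂ b₃ z₁ z₂ z₃
    := denominatorᵖ a₃ a₁ a₂ b₃ b₁ b₂ z₃ z₁ z₂)
  refl

fraction-product-*-cancel : ∀ z x₁ x₂ y₁ y₂ r u v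
  → .{{_ : NonZero z}} → .{{_ : NonZero x₁}} → .{{_ : NonZero x₂}}
  → .{{_ : NonZero y₁}} → .{{_ : NonZero y₂}}
  → (1/ z) * ((u ÷ x₁) ÷ y₁) * ((v ÷ x₂) ÷ y₂) * (z * x₁ * x₂ * y₁ * y₂ * r) ≡ r * u * v
fraction-product-*-cancel z x₁ x₂ y₁ y₂ r u v = begin
  (1/ z) * ((u ÷ x₁) ÷ y₁) * ((v ÷ x₂) ÷ y₂) * (z * x₁ * x₂ * y₁ * y₂ * r)
    ≡⟨ solve 13 (λ iz ix₁ ix₂ iy₁ iy₂ z x₁ x₂ y₁ y₂ r u v →
         iz :* (u :* ix₁ :* iy₁) :* (v :* ix₂ :* iy₂) :* (z :* x₁ :* x₂ :* y₁ :* y₂ :* r)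
         := iz :* z :* (ix₁ :* x₁) :* (ix₂ :* x₂) :* (iy₁ :* y₁) :* (iy₂ :* y₂) :* (r :* u :* v))
       refl (1/ z) (1/ x₁) (1/ x₂) (1/ y₁) (1/ y₂) z x₁ x₂ y₁ y₂ r u v ⟩
  (1/ z) * z * ((1/ x₁) * x₁) * ((1/ x₂) * x₂) * ((1/ y₁) * y₁) * ((1/ y₂) * y₂) * (r * u * v)
    ≡⟨ cong (_* (r * u * v)) (cong₂ _*_ (cong₂ _*_ (cong₂ _*_ (cong₂ _*_
         (*-inverseˡ z) (*-inverseˡ x₁)) (*-inverseˡ x₂)) (*-inverseˡ y₁)) (*-inverseˡ y₂)) ⟩
  1ℚ * 1ℚ * 1ℚ * 1ℚ * 1ℚ * (r * u * v)
    ≡⟨ *-identityˡ (r * u * v) ⟩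
  r * u * v ∎

summand : ∀ a₁ a₂ a₃ b₁ b₂ b₃ z₁ z₂ z₃
  → .{{_ : NonZero z₁}} → .{{_ : NonZero (a₁ - a₂)}} → .{{_ : NonZero (a₁ - a₃)}}
  → .{{_ : NonZero (b₁ - b₂)}} → .{{_ : NonZero (b₁ - b₃)}} → ℚ
summand a₁ a₂ a₃ b₁ b₂ b₃ z₁ z₂ z₃ =
  (1/ z₁) * (((z₁ - z₂) ÷ (a₁ - a₂)) ÷ (b₁ - b₂)) * (((z₁ - z₃) ÷ (a₁ - a₃)) ÷ (b₁ - b₃))

summand-*-denominator : ∀ a₁ a₂ a₃ b₁ b₂ b₃ z₁ z₂ z₃
  → .{{_ : NonZero z₁}} → .{{_ : NonZero (a₁ - a₂)}} → .{{_ : NonZero (a₁ - a₃)}}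
  → .{{_ : NonZero (b₁ - b₂)}} → .{{_ : NonZero (b₁ - b₃)}}
  → summand a₁ a₂ a₃ b₁ b₂ b₃ z₁ z₂ z₃ * denominator a₁ a₂ a₃ b₁ b₂ b₃ z₁ z₂ z₃
    ≡ z₂ * z₃ * (a₂ - a₃) * (b₂ - b₃) * (z₁ - z₂) * (z₁ - z₃)
summand-*-denominator a₁ a₂ a₃ b₁ b₂ b₃ z₁ z₂ z₃ =
  trans (cong (summand a₁ a₂ a₃ b₁ b₂ b₃ z₁ z₂ z₃ *_) (denominator-split a₁ a₂ a₃ b₁ b₂ b₃ z₁ z₂ z₃))
        (fraction-product-*-cancel z₁ _ _ _ _ _ _ _)

cleared-numerator : ∀ a₁ a₂ a₃ b₁ b₂ b₃ z₁ z₂ z₃ →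
  z₂ * z₃ * (a₂ - a₃) * (b₂ - b₃) * (z₁ - z₂) * (z₁ - z₃)
    + z₁ * z₃ * (a₁ - a₃) * (b₁ - b₃) * (z₂ - z₁) * (z₂ - z₃)
    + z₁ * z₂ * (a₁ - a₂) * (b₁ - b₂) * (z₃ - z₁) * (z₃ - z₂)
  ≡ det3 (a₁ * z₁) (a₂ * z₂) (a₃ * z₃) z₁ z₂ z₃ 1ℚ 1ℚ 1ℚ
    * det3 (b₁ * z₁) (b₂ * z₂) (b₃ * z₃) z₁ z₂ z₃ 1ℚ 1ℚ 1ℚ
cleared-numerator = solve 9 (λ a₁ a₂ a₃ b₁ b₂ b₃ z₁ z₂ z₃ →
    z₂ :* z₃ :* (a₂ :- a₃) :* (b₂ :- b₃) :* (z₁ :- z₂) :* (z₁ :- z₃)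
    :+ z₁ :* z₃ :* (a₁ :- a₃) :* (b₁ :- b₃) :* (z₂ :- z₁) :* (z₂ :- z₃)
    :+ z₁ :* z₂ :* (a₁ :- a₂) :* (b₁ :- b₂) :* (z₃ :- z₁) :* (z₃ :- z₂)
    := det (a₁ :* z₁) (a₂ :* z₂) (a₃ :* z₃) z₁ z₂ z₃ :* det (b₁ :* z₁) (b₂ :* z₂) (b₃ :* z₃) z₁ z₂ z₃)
  refl
  where
  det : ∀ {n} → (_ _ _ _ _ _ : Polynomial n) → Polynomial n
  det m₁₁ m₁₂ m₁₃ m₂₁ m₂₂ m₂₃ =
    m₁₁ :* m₂₂ :* con 1ℚ :+ m₁₂ :* m₂₃ :* con 1ℚ :+ m₁₃ :* m₂₁ :* con 1ℚ
    :- m₁₃ :* m₂₂ :* con 1ℚ :- m₁₂ :* m₂₁ :* con 1ℚ :- m₁₁ :* m₂₃ :* con 1ℚ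

x*d≡y⇒x≡1/d*y : ∀ x d y → .{{_ : NonZero d}} → x * d ≡ y → x ≡ (1/ d) * y
x*d≡y⇒x≡1/d*y x d y xd≡y = begin
  x                ≡⟨ sym (*-identityʳ x) ⟩
  x * 1ℚ           ≡⟨ cong (x *_) (sym (*-inverseʳ d)) ⟩
  x * (d * 1/ d)   ≡⟨ sym (*-assoc x d (1/ d)) ⟩
  x * d * 1/ d     ≡⟨ cong (_* 1/ d) xd≡y ⟩
  y * 1/ d         ≡⟨ solve 2 (λ y e → y :* e := e :* y) refl y (1/ d) ⟩
  (1/ d) * y       ∎

lemmaA1 : (a₁ a₂ a₃ b₁ b₂ b₃ z₁ z₂ z₃ : ℚ)
    → {{_ : NonZero z₁}} → {{_ : NonZero z₂}} → {{_ : NonZero z₃}}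
    → {{_ : NonZero (a₁ - a₂)}} → {{_ : NonZero (a₁ - a₃)}}
    → {{_ : NonZero (a₂ - a₁)}} → {{_ : NonZero (a₂ - a₃)}}
    → {{_ : NonZero (a₃ - a₁)}} → {{_ : NonZero (a₃ - a₂)}}
    → {{_ : NonZero (b₁ - b₂)}} → {{_ : NonZero (b₁ - b₃)}}
    → {{_ : NonZero (b₂ - b₁)}} → {{_ : NonZero (b₂ - b₃)}}
    → {{_ : NonZero (b₃ - b₁)}} → {{_ : NonZero (b₃ - b₂)}}
    → {{_ : NonZero (z₁ * z₂ * z₃ * V3 a₁ a₂ a₃ * V3 b₁ b₂ b₃)}}
    → ((1/ z₁) * (((z₁ - z₂) ÷ (a₁ - a₂)) ÷ (b₁ - b₂))
               * (((z₁ - z₃) ÷ (a₁ - a₃)) ÷ (b₁ - b₃))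
       + (1/ z₂) * (((z₂ - z₁) ÷ (a₂ - a₁)) ÷ (b₂ - b₁))
                 * (((z₂ - z₃) ÷ (a₂ - a₃)) ÷ (b₂ - b₃)))
       + (1/ z₃) * (((z₃ - z₁) ÷ (a₃ - a₁)) ÷ (b₃ - b₁))
                 * (((z₃ - z₂) ÷ (a₃ - a₂)) ÷ (b₃ - b₂))
      ≡ (1/ (z₁ * z₂ * z₃ * V3 a₁ a₂ a₃ * V3 b₁ b₂ b₃))
        * det3 (a₁ * z₁) (a₂ * z₂) (a₃ * z₃) z₁ z₂ z₃ 1ℚ 1ℚ 1ℚ
        * det3 (b₁ * z₁) (b₂ * z₂) (b₃ * z₃) z₁ z₂ z₃ 1ℚ 1ℚ 1ℚ
lemmaA1 a₁ a₂ a₃ b₁ b₂ b₃ z₁ z₂ z₃ = begin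
  s₁ + s₂ + s₃          ≡⟨ x*d≡y⇒x≡1/d*y (s₁ + s₂ + s₃) D (d₁ * d₂) cleared ⟩
  (1/ D) * (d₁ * d₂)    ≡⟨ sym (*-assoc (1/ D) d₁ d₂) ⟩
  (1/ D) * d₁ * d₂      ∎
  where
  D  = denominator a₁ a₂ a₃ b₁ b₂ b₃ z₁ z₂ z₃
  d₁ = det3 (a₁ * z₁) (a₂ * z₂) (a₃ * z₃) z₁ z₂ z₃ 1ℚ 1ℚ 1ℚ
  d₂ = det3 (b₁ * z₁) (b₂ * z₂) (b₃ * z₃) z₁ z₂ z₃ 1ℚ 1ℚ 1ℚ
  s₁ = summand a₁ a₂ a₃ b₁ b₂ b₃ z₁ z₂ z₃
  s₂ = summand a₂ a₁ a₃ b₂ b₁ b₃ z₂ z₁ z₃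
  s₃ = summand a₃ a₁ a₂ b₃ b₁ b₂ z₃ z₁ z₂

  cleared : (s₁ + s₂ + s₃) * D ≡ d₁ * d₂
  cleared = begin
    (s₁ + s₂ + s₃) * D
      ≡⟨ trans (*-distribʳ-+ D (s₁ + s₂) s₃) (cong (_+ s₃ * D) (*-distribʳ-+ D s₁ s₂)) ⟩
    s₁ * D + s₂ * D + s₃ * D
      ≡⟨ cong₂ _+_ (cong₂ _+_
           (summand-*-denominator a₁ a₂ a₃ b₁ b₂ b₃ z₁ z₂ z₃)
           (trans (cong (s₂ *_) (denominator-swap₁₂ a₁ a₂ a₃ b₁ b₂ b₃ z₁ z₂ z₃))
                  (summand-*-denominator a₂ a₁ a₃ b₂ b₁ b₃ z₂ z₁ z₃)))
           (trans (cong (s₃ *_) (denominator-rotate a₁ a₂ a₃ b₁ b₂ b₃ z₁ z₂ z₃))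
                  (summand-*-denominator a₃ a₁ a₂ b₃ b₁ b₂ z₃ z₁ z₂)) ⟩
    _ ≡⟨ cleared-numerator a₁ a₂ a₃ b₁ b₂ b₃ z₁ z₂ z₃ ⟩
    d₁ * d₂ ∎
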